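{- Let $k\ge2$ be an integer, let $p$ be a prime, and let $\mathbf a,\mathbf a'\in\mathbb F_p^{\mathbb N_0}$ be $k$-regular sequences such that for every $i\in\{0,1,\dots,k-1\}$ the maps $T_i\colon\mathcal M_k(\mathbf a)\to\mathcal M_k(\mathbf a)$ and $T_i\colon\mathcal M_k(\mathbf a')\to\mathcal M_k(\mathbf a')$ are invertible. If $\mathbf a\simeq\mathbf a'$ then $\mathbf a=\mathbf a'$.
   Context: For $\mathbf b=(b_n)_{n\ge0}\in\mathbb F_p^{\mathbb N_0}$, the $k$-kernel is $\mathcal N_k(\mathbf b)=\{(b_{k^jn+r})_{n=0}^\infty: j,r\in\mathbb N_0,\ r<k^j\}$ and $\mathcal M_k(\mathbf b)$ is the $\mathbb F_p$-linear span of $\mathcal N_k(\mathbf b)$ (pointwise operations); $\mathbf b$ is $k$-regular if $\mathcal M_k(\mathbf b)$ is finitely generated (finite-dimensional). For $i\in\{0,\dots,k-1\}$, $T_i$ is the linear map $T_i(\mathbf b)=(b_{kn+i})_{n=0}^\infty$, which maps $\mathcal M_k(\mathbf b)$ into itself. $\mathbf a\simeq\mathbf a'$ means $\frac1N\#\{0\le n<N:a_n\ne a'_n\}\to0$. -}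

module Defs where

open import Data.Nat using (ℕ; zero; suc; _+_; _*_; _^_; _≤_; _<_; NonZero)
open import Data.Nat.DivMod using (_mod_)
open import Data.Fin using (Fin; toℕ; _≟_)
open import Data.List using (List; []; _∷_)
open import Data.List.Relation.Unary.All using (All)
open import Data.List.Membership.Propositional using (_∈_)
open import Data.Product using (Σ; ∃; _×_; _,_; proj₂)
open import Relation.Binary.PropositionalEquality using (_≡_)
open import Relation.Nullary using (does)
open import Data.Bool using (if_then_else_)

-- Sequences over F_p = Z/pZ, represented as Fin p with arithmetic mod p.
Seq : ℕ → Set
Seq p = ℕ → Fin p

_≈_ : ∀ {p} → Seq p → Seq p → Set
a ≈ b = ∀ n → a n ≡ b n

module _ (p : ℕ) .{{_ : NonZero p}} where

  lincomb : List (Fin p × Seq p) → Seq p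
  lincomb [] n = 0 mod p
  lincomb ((c , s) ∷ l) n = (toℕ c * toℕ (s n) + toℕ (lincomb l n)) mod p

  InSpan : (Seq p → Set) → Seq p → Set
  InSpan S b = Σ (List (Fin p × Seq p)) λ L → All (λ cs → S (proj₂ cs)) L × (b ≈ lincomb L)

  Kernel : ℕ → Seq p → Seq p → Set
  Kernel k a s = Σ ℕ λ j → Σ ℕ λ r → r < k ^ j × (s ≈ λ n → a (k ^ j * n + r))

  M : ℕ → Seq p → Seq p → Set
  M k a = InSpan (Kernel k a)

  Regular : ℕ → Seq p → Set
  Regular k a = Σ (List (Seq p)) λ gs → All (M k a) gs × (∀ b → M k a b → InSpan (_∈ gs) b)

  T : ℕ → ℕ → Seq p → Seq p
  T k i b n = b (k * n + i)

  TInvertible : ℕ → ℕ → Seq p → Set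
  TInvertible k i a =
    (∀ b c → M k a b → M k a c → T k i b ≈ T k i c → b ≈ c) ×
    (∀ c → M k a c → Σ (Seq p) λ b → M k a b × (T k i b ≈ c))

diffCount : ∀ {p} → Seq p → Seq p → ℕ → ℕ
diffCount a a' zero = 0
diffCount a a' (suc N) = diffCount a a' N + (if does (a N ≟ a' N) then 0 else 1)

-- a ≃ a' : (1/N) #{n < N : a_n ≠ a'_n} → 0, i.e. for every m there is N₀ with
-- m · #{…} ≤ N for all N ≥ N₀
AsympEq : ∀ {p} → Seq p → Seq p → Set
AsympEq a a' = ∀ (m : ℕ) → ∃ λ N₀ → ∀ N → N₀ ≤ N → m * diffCount a a' N ≤ N

{-# OPTIONS --safe #-}
-- Regularity makes M_k(a) and M_k(a') finite, so the pairs (T_w a, T_w a'), for words w of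
-- base-k digits, take at most K values. Since the T_i are injective there, some power of w
-- brings every such pair back to (a, a'), and cutting loops out of that return word leaves
-- one of length at most K. Hence a mismatch a n₀ ≠ a' n₀ forces, for every w, a mismatch of
-- T_w a and T_w a' below B = k^K (n₀ + 1). Taking for w the digits of a residue r mod k^N,
-- every residue class mod k^N contains a mismatch below B k^N: the mismatches have lower
-- density at least 1/B, contradicting a ≃ a'.
module Submission where

open import Defs
open import Data.Nat using (ℕ; zero; suc; _+_; _*_; _^_; _∸_; _⊓_; _≤_; _<_; z≤n; s≤s; NonZero; _≤?_; >-nonZero; >-nonZero⁻¹)
open import Data.Nat.Properties
open import Data.Nat.DivMod
open import Data.Nat.Primality using (Prime)
open import Data.Nat.Solver using (module +-*-Solver)
open import Algebra.Properties.CommutativeSemigroup +-commutativeSemigroup using () renaming (interchange to +-interchange)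
open import Data.Fin using (Fin; toℕ; combine; funToFin; finToFun) renaming (_≟_ to _≟ᶠ_)
open import Data.Fin.Properties using (toℕ-injective; toℕ-fromℕ<; toℕ<n; finToFun-funToFin; combine-injective)
  renaming (pigeonhole to Fin-pigeonhole)
open import Data.List as List using (List; []; _∷_; _++_; length; take; drop)
import Data.List.Properties as List
open import Data.List.Relation.Unary.All as All using (All; []; _∷_)
import Data.List.Relation.Unary.All.Properties as All
import Data.List.Relation.Unary.Any as Any
open import Data.List.Relation.Unary.Any.Properties using (lookup-index)
open import Data.List.Membership.Propositional using (_∈_)
open import Data.Product using (∃; ∃₂; _×_; _,_; proj₁; proj₂; map₂)
open import Data.Product.Relation.Binary.Pointwise.NonDependent using (Pointwise)
open import Data.Bool using (if_then_else_)
open import Data.Sum using (inj₁; inj₂)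
open import Function using (_∘_)
open import Relation.Nullary using (¬_; yes; no; does; contradiction)
open import Relation.Binary.PropositionalEquality

record Finite {A : Set} (_∼_ : A → A → Set) (P : A → Set) : Set where
  field
    size            : ℕ
    index           : ∀ {x} → P x → Fin size
    index-injective : ∀ {x y} (px : P x) (py : P y) → index px ≡ index py → x ∼ y

  pigeonhole : (xs : ℕ → A) → (∀ i → P (xs i)) → ∃₂ λ i j → i < j × j ≤ size × xs i ∼ xs j
  pigeonhole xs pxs with Fin-pigeonhole (n<1+n size) (λ i → index (pxs (toℕ i)))
  ... | i , j , i<j , same = toℕ i , toℕ j , i<j , ≤-pred (toℕ<n j) , index-injective _ _ same

Finite-weaken : ∀ {A : Set} {_∼_ : A → A → Set} {P Q : A → Set} →
                (∀ {x} → P x → Q x) → Finite _∼_ Q → Finite _∼_ P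
Finite-weaken P⊆Q finQ = record
  { size = size
  ; index = index ∘ P⊆Q
  ; index-injective = λ px py → index-injective (P⊆Q px) (P⊆Q py)
  }
  where open Finite finQ

Finite-× : ∀ {A B : Set} {_∼_ : A → A → Set} {_≃_ : B → B → Set} {P : A → Set} {Q : B → Set} →
           Finite _∼_ P → Finite _≃_ Q → Finite (Pointwise _∼_ _≃_) (λ xy → P (proj₁ xy) × Q (proj₂ xy))
Finite-× finP finQ = record
  { size = P.size * Q.size
  ; index = λ (px , qy) → combine (P.index px) (Q.index qy)
  ; index-injective = λ (px , qy) (px' , qy') same →
      let sameP , sameQ = combine-injective _ _ _ _ same
      in P.index-injective px px' sameP , Q.index-injective qy qy' sameQ
  }
  where module P = Finite finP
        module Q = Finite finQ

sumBelow : (ℕ → ℕ) → ℕ → ℕ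
sumBelow f zero    = 0
sumBelow f (suc N) = sumBelow f N + f N

sumBelow-cong : ∀ {f g} → (∀ n → f n ≡ g n) → ∀ N → sumBelow f N ≡ sumBelow g N
sumBelow-cong f≡g zero    = refl
sumBelow-cong f≡g (suc N) = cong₂ _+_ (sumBelow-cong f≡g N) (f≡g N)

sumBelow-zero : ∀ N → sumBelow (λ _ → 0) N ≡ 0
sumBelow-zero zero    = refl
sumBelow-zero (suc N) = trans (+-identityʳ _) (sumBelow-zero N)

sumBelow-+ : ∀ f g N → sumBelow (λ n → f n + g n) N ≡ sumBelow f N + sumBelow g N
sumBelow-+ f g zero    = refl
sumBelow-+ f g (suc N) = begin
  sumBelow (λ n → f n + g n) N + (f N + g N) ≡⟨ cong (_+ (f N + g N)) (sumBelow-+ f g N) ⟩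
  (sumBelow f N + sumBelow g N) + (f N + g N) ≡⟨ +-interchange (sumBelow f N) _ _ _ ⟩
  (sumBelow f N + f N) + (sumBelow g N + g N) ∎
  where open ≡-Reasoning

sumBelow-split : ∀ f N R → sumBelow f (N + R) ≡ sumBelow f N + sumBelow (λ r → f (N + r)) R
sumBelow-split f N zero    rewrite +-identityʳ N = sym (+-identityʳ _)
sumBelow-split f N (suc R) rewrite +-suc N R =
  trans (cong (_+ f (N + R)) (sumBelow-split f N R)) (+-assoc (sumBelow f N) _ _)

sumBelow-blocks : ∀ f R B → sumBelow f (B * R) ≡ sumBelow (λ m → sumBelow (λ r → f (R * m + r)) R) B
sumBelow-blocks f R zero    = refl
sumBelow-blocks f R (suc B) = begin
  sumBelow f (R + B * R)                               ≡⟨ cong (sumBelow f) (+-comm R (B * R)) ⟩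
  sumBelow f (B * R + R)                               ≡⟨ sumBelow-split f (B * R) R ⟩
  sumBelow f (B * R) + sumBelow (λ r → f (B * R + r)) R
    ≡⟨ cong₂ _+_ (sumBelow-blocks f R B) (sumBelow-cong (λ r → cong (λ z → f (z + r)) (*-comm B R)) R) ⟩
  sumBelow (λ m → sumBelow (λ r → f (R * m + r)) R) B + sumBelow (λ r → f (R * B + r)) R ∎
  where open ≡-Reasoning

sumBelow-swap : ∀ (g : ℕ → ℕ → ℕ) R B →
  sumBelow (λ m → sumBelow (g m) R) B ≡ sumBelow (λ r → sumBelow (λ m → g m r) B) R
sumBelow-swap g R zero    = sym (sumBelow-zero R)
sumBelow-swap g R (suc B) =
  trans (cong (_+ sumBelow (g B) R) (sumBelow-swap g R B))
        (sym (sumBelow-+ (λ r → sumBelow (λ m → g m r) B) (g B) R))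

term≤sumBelow : ∀ f {m N} → m < N → f m ≤ sumBelow f N
term≤sumBelow f {m} {suc N} m<1+N with m<1+n⇒m<n∨m≡n m<1+N
... | inj₁ m<N = ≤-trans (term≤sumBelow f m<N) (m≤m+n _ _)
... | inj₂ refl = m≤n+m _ _

sumBelow-ones : ∀ f R → (∀ r → r < R → 1 ≤ f r) → R ≤ sumBelow f R
sumBelow-ones f zero    _    = z≤n
sumBelow-ones f (suc R) f≥1 = subst (_≤ sumBelow f R + f R) (+-comm R 1)
  (+-mono-≤ (sumBelow-ones f R (λ r r<R → f≥1 r (m≤n⇒m≤1+n r<R))) (f≥1 R ≤-refl))

-- Summed by residue classes mod R, each class contributes at least 1.
hitsEveryResidue⇒≤sumBelow : ∀ f R B → (∀ r → r < R → ∃ λ m → m < B × 1 ≤ f (R * m + r)) →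
                             R ≤ sumBelow f (B * R)
hitsEveryResidue⇒≤sumBelow f R B hits = subst (R ≤_) (sym byResidues)
  (sumBelow-ones _ R λ r r<R → let m , m<B , hit = hits r r<R in
    ≤-trans hit (term≤sumBelow (λ m → f (R * m + r)) m<B))
  where
    byResidues : sumBelow f (B * R) ≡ sumBelow (λ r → sumBelow (λ m → f (R * m + r)) B) R
    byResidues = trans (sumBelow-blocks f R B) (sumBelow-swap (λ m r → f (R * m + r)) R B)

Sparse : (ℕ → ℕ) → Set
Sparse count = ∀ m → ∃ λ N₀ → ∀ N → N₀ ≤ N → m * count N ≤ N

n<k^n : ∀ {k} → 1 < k → ∀ n → n < k ^ n
n<k^n 1<k zero    = s≤s z≤n
n<k^n {k} 1<k (suc n) = ≤-<-trans (n<k^n 1<k n) (^-monoʳ-< k 1<k (n<1+n n))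

dense⇒¬Sparse : ∀ {k} → 1 < k → ∀ count B .{{_ : NonZero B}} →
                (∀ N → k ^ N ≤ count (B * k ^ N)) → ¬ Sparse count
dense⇒¬Sparse {k} 1<k count B dense sparse with sparse (suc B)
... | N₀ , bound = <-irrefl refl (begin-strict
    B * R                 <⟨ +-monoˡ-< (B * R) (≤-<-trans z≤n (n<k^n 1<k N₀)) ⟩
    suc B * R             ≤⟨ *-monoʳ-≤ (suc B) (dense N₀) ⟩
    suc B * count (B * R) ≤⟨ bound (B * R) N₀≤BR ⟩
    B * R                 ∎)
  where
    open ≤-Reasoning
    R = k ^ N₀
    N₀≤BR : N₀ ≤ B * R
    N₀≤BR = ≤-trans (<⇒≤ (n<k^n 1<k N₀)) (m≤n*m R B)

module _ {p : ℕ} where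

  FactorsThrough : ∀ {m} → (ℕ → Fin m) → Seq p → Set
  FactorsThrough {m} c b = ∃ λ (F : Fin m → Fin p) → b ≈ (F ∘ c)

  factorsThrough-finite : ∀ {m} (c : ℕ → Fin m) → Finite _≈_ (FactorsThrough c)
  factorsThrough-finite {m} c = record
    { size = p ^ m
    ; index = λ (F , _) → funToFin F
    ; index-injective = λ { {b} {b'} (F , b≈Fc) (G , b'≈Gc) same n → begin
        b n                         ≡⟨ b≈Fc n ⟩
        F (c n)                     ≡⟨ finToFun-funToFin F (c n) ⟨
        finToFun (funToFin F) (c n) ≡⟨ cong (λ h → finToFun h (c n)) same ⟩
        finToFun (funToFin G) (c n) ≡⟨ finToFun-funToFin G (c n) ⟩
        G (c n)                     ≡⟨ b'≈Gc n ⟨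
        b' n                        ∎ }
    }
    where open ≡-Reasoning

module _ {p : ℕ} .{{_ : NonZero p}} where

  valuesAt : (gs : List (Seq p)) → ℕ → Fin (p ^ length gs)
  valuesAt gs n = funToFin (λ i → List.lookup gs i n)

  evalCombination : ∀ {gs : List (Seq p)} (L : List (Fin p × Seq p)) → All (λ cs → proj₂ cs ∈ gs) L →
                    (Fin (length gs) → Fin p) → Fin p
  evalCombination []            []             v = 0 mod p
  evalCombination ((c , s) ∷ L) (s∈gs ∷ L⊆gs) v =
    (toℕ c * toℕ (v (Any.index s∈gs)) + toℕ (evalCombination L L⊆gs v)) mod p

  lincomb-evalCombination : ∀ {gs n} {v : Fin (length gs) → Fin p} → (∀ i → v i ≡ List.lookup gs i n) →
    ∀ L (L⊆gs : All (λ cs → proj₂ cs ∈ gs) L) → lincomb p L n ≡ evalCombination L L⊆gs v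
  lincomb-evalCombination v≡ []            []             = refl
  lincomb-evalCombination {n = n} v≡ ((c , s) ∷ L) (s∈gs ∷ L⊆gs) =
    cong₂ (λ x y → (toℕ c * toℕ x + toℕ y) mod p)
          (trans (cong (λ f → f n) (lookup-index s∈gs)) (sym (v≡ (Any.index s∈gs))))
          (lincomb-evalCombination v≡ L L⊆gs)

  span-factorsThrough : ∀ gs {b} → InSpan p (_∈ gs) b → FactorsThrough (valuesAt gs) b
  span-factorsThrough gs (L , L⊆gs , b≈L) =
    (λ c → evalCombination L L⊆gs (finToFun c)) ,
    (λ n → trans (b≈L n) (lincomb-evalCombination (finToFun-funToFin _) L L⊆gs))

  regular-finite : ∀ {k a} → Regular p k a → Finite _≈_ (M p k a)
  regular-finite (gs , _ , spans) =
    Finite-weaken (λ {b} b∈M → span-factorsThrough gs (spans b b∈M)) (factorsThrough-finite (valuesAt gs))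

  toℕ-mod : ∀ m → toℕ (m mod p) ≡ m % p
  toℕ-mod m = toℕ-fromℕ< (m%n<n m p)

  lincomb-unit : ∀ s → lincomb p ((1 mod p , s) ∷ []) ≈ s
  lincomb-unit s n = toℕ-injective (begin
    toℕ (lincomb p ((1 mod p , s) ∷ []) n)   ≡⟨ toℕ-mod _ ⟩
    (toℕ (1 mod p) * x + toℕ (0 mod p)) % p
      ≡⟨ cong₂ (λ u v → (u * x + v) % p) (toℕ-mod 1) (trans (toℕ-mod 0) (m<n⇒m%n≡m (>-nonZero⁻¹ p))) ⟩
    ((1 % p) * x + 0) % p       ≡⟨ cong (_% p) (+-identityʳ _) ⟩
    ((1 % p) * x) % p           ≡⟨ %-distribˡ-* (1 % p) x p ⟩
    ((1 % p % p) * (x % p)) % p ≡⟨ cong (λ u → (u * (x % p)) % p) (m%n%n≡m%n 1 p) ⟩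
    ((1 % p) * (x % p)) % p     ≡⟨ %-distribˡ-* 1 x p ⟨
    (1 * x) % p                 ≡⟨ cong (_% p) (*-identityˡ x) ⟩
    x % p                       ≡⟨ m<n⇒m%n≡m (toℕ<n (s n)) ⟩
    x                           ∎)
    where open ≡-Reasoning
          x = toℕ (s n)

  M-self : ∀ k a → M p k a a
  M-self k a = (1 mod p , a) ∷ [] , a∈kernel ∷ [] , λ n → sym (lincomb-unit a n)
    where a∈kernel : Kernel p k a a
          a∈kernel = 0 , 0 , s≤s z≤n , λ n → cong a (sym (trans (+-identityʳ _) (*-identityˡ n)))

length-take++drop< : ∀ {A : Set} (u : List A) {i j} → i < j → j ≤ length u →
                     length (take i u ++ drop j u) < length u
length-take++drop< u {i} {j} i<j j≤|u| = begin-strict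
  length (take i u ++ drop j u)          ≡⟨ List.length-++ (take i u) ⟩
  length (take i u) + length (drop j u)  ≡⟨ cong₂ _+_ (List.length-take i u) (List.length-drop j u) ⟩
  i ⊓ length u + (length u ∸ j)          ≤⟨ +-monoˡ-≤ _ (m⊓n≤m i (length u)) ⟩
  i + (length u ∸ j)                     <⟨ +-monoˡ-< _ i<j ⟩
  j + (length u ∸ j)                     ≡⟨ m+[n∸m]≡n j≤|u| ⟩
  length u                               ∎
  where open ≤-Reasoning

_^ʷ_ : ∀ {A : Set} → List A → ℕ → List A
w ^ʷ zero  = []
w ^ʷ suc n = w ++ w ^ʷ n

^ʷ-+ : ∀ {A : Set} (w : List A) m n → w ^ʷ (m + n) ≡ w ^ʷ m ++ w ^ʷ n
^ʷ-+ w zero    n = refl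
^ʷ-+ w (suc m) n = trans (cong (w ++_) (^ʷ-+ w m n)) (sym (List.++-assoc w (w ^ʷ m) (w ^ʷ n)))

All-^ʷ : ∀ {A : Set} {P : A → Set} {w} → All P w → ∀ n → All P (w ^ʷ n)
All-^ʷ Pw zero    = []
All-^ʷ Pw (suc n) = All.++⁺ Pw (All-^ʷ Pw n)

module Words {p : ℕ} .{{_ : NonZero p}} {k : ℕ} .{{_ : NonZero k}} where

  Digits : List ℕ → Set
  Digits = All (_< k)

  fromDigits : List ℕ → ℕ
  fromDigits []      = 0
  fromDigits (i ∷ w) = i + k * fromDigits w

  toDigits : ℕ → ℕ → List ℕ
  toDigits zero    r = []
  toDigits (suc L) r = r % k ∷ toDigits L (r / k)

  length-toDigits : ∀ L r → length (toDigits L r) ≡ L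
  length-toDigits zero    r = refl
  length-toDigits (suc L) r = cong suc (length-toDigits L (r / k))

  toDigits-digits : ∀ L r → Digits (toDigits L r)
  toDigits-digits zero    r = []
  toDigits-digits (suc L) r = m%n<n r k ∷ toDigits-digits L (r / k)

  fromDigits-toDigits : ∀ L r → r < k ^ L → fromDigits (toDigits L r) ≡ r
  fromDigits-toDigits zero    zero    _        = refl
  fromDigits-toDigits zero    (suc r) (s≤s ())
  fromDigits-toDigits (suc L) r       r<k^1+L = begin
    r % k + k * fromDigits (toDigits L (r / k)) ≡⟨ cong (λ z → r % k + k * z) (fromDigits-toDigits L (r / k) r/k<k^L) ⟩
    r % k + k * (r / k)                         ≡⟨ cong (r % k +_) (*-comm k (r / k)) ⟩
    r % k + r / k * k                           ≡⟨ m≡m%n+[m/n]*n r k ⟨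
    r                                           ∎
    where open ≡-Reasoning
          r/k<k^L = m<n*o⇒m/o<n (subst (r <_) (*-comm k (k ^ L)) r<k^1+L)

  fromDigits< : ∀ {w} → Digits w → fromDigits w < k ^ length w
  fromDigits< []                  = s≤s z≤n
  fromDigits< {i ∷ w} (i<k ∷ dw) = begin-strict
    i + k * fromDigits w   <⟨ +-monoˡ-< (k * fromDigits w) i<k ⟩
    k + k * fromDigits w   ≡⟨ *-suc k (fromDigits w) ⟨
    k * suc (fromDigits w) ≤⟨ *-monoʳ-≤ k (fromDigits< dw) ⟩
    k * k ^ length w       ∎
    where open ≤-Reasoning

  shift+fromDigits< : ∀ {w} → Digits w → ∀ n → k ^ length w * n + fromDigits w < k ^ length w * suc n
  shift+fromDigits< {w} dw n = begin-strict
    k ^ length w * n + fromDigits w  <⟨ +-monoʳ-< _ (fromDigits< dw) ⟩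
    k ^ length w * n + k ^ length w  ≡⟨ +-comm _ (k ^ length w) ⟩
    k ^ length w + k ^ length w * n  ≡⟨ *-suc (k ^ length w) n ⟨
    k ^ length w * suc n             ∎
    where open ≤-Reasoning

  T* : List ℕ → Seq p → Seq p
  T* []      b = b
  T* (i ∷ w) b = T* w (T p k i b)

  T*-++ : ∀ u v b → T* (u ++ v) b ≡ T* v (T* u b)
  T*-++ []      v b = refl
  T*-++ (i ∷ u) v b = T*-++ u v (T p k i b)

  T*-cong : ∀ w {b c} → b ≈ c → T* w b ≈ T* w c
  T*-cong []      b≈c = b≈c
  T*-cong (i ∷ w) b≈c = T*-cong w (λ n → b≈c (k * n + i))

  T*-index : ∀ w b n → T* w b n ≡ b (k ^ length w * n + fromDigits w)
  T*-index []      b n = cong b (sym (trans (+-identityʳ _) (*-identityˡ n)))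
  T*-index (i ∷ w) b n = trans (T*-index w (T p k i b) n) (cong b (reassoc (k ^ length w) (fromDigits w)))
    where
      open +-*-Solver
      reassoc : ∀ X v → k * (X * n + v) + i ≡ k * X * n + (i + k * v)
      reassoc X v = solve 5 (λ K X N I V → K :* (X :* N :+ V) :+ I := K :* X :* N :+ (I :+ K :* V)) refl k X n i v

  T*-toDigits : ∀ L r → r < k ^ L → ∀ b n → T* (toDigits L r) b n ≡ b (k ^ L * n + r)
  T*-toDigits L r r<k^L b n = trans (T*-index (toDigits L r) b n)
    (cong₂ (λ e d → b (k ^ e * n + d)) (length-toDigits L r) (fromDigits-toDigits L r r<k^L))

  T*-removeLoop : ∀ u i j b → T* (take i u) b ≈ T* (take j u) b → T* u b ≈ T* (take i u ++ drop j u) b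
  T*-removeLoop u i j b loop n = begin
    T* u b n                             ≡⟨ cong (λ w → T* w b n) (List.take++drop≡id j u) ⟨
    T* (take j u ++ drop j u) b n        ≡⟨ cong (λ f → f n) (T*-++ (take j u) (drop j u) b) ⟩
    T* (drop j u) (T* (take j u) b) n    ≡⟨ T*-cong (drop j u) loop n ⟨
    T* (drop j u) (T* (take i u) b) n    ≡⟨ cong (λ f → f n) (T*-++ (take i u) (drop j u) b) ⟨
    T* (take i u ++ drop j u) b n        ∎
    where open ≡-Reasoning

  Kernel-T : ∀ {a s i} → i < k → Kernel p k a s → Kernel p k a (T p k i s)
  Kernel-T {a} {s} {i} i<k (j , r , r<k^j , s≈) =
    suc j , r' , r'<k^1+j , λ n → trans (s≈ (k * n + i)) (cong a (reassoc n))
    where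
      r' = k ^ j * i + r
      open +-*-Solver
      reassoc : ∀ n → k ^ j * (k * n + i) + r ≡ k ^ suc j * n + r'
      reassoc n = solve 5 (λ X K N I R → X :* (K :* N :+ I) :+ R := K :* X :* N :+ (X :* I :+ R)) refl (k ^ j) k n i r
      r'<k^1+j : r' < k ^ suc j
      r'<k^1+j = begin-strict
        k ^ j * i + r       <⟨ +-monoʳ-< (k ^ j * i) r<k^j ⟩
        k ^ j * i + k ^ j   ≡⟨ +-comm (k ^ j * i) _ ⟩
        k ^ j + k ^ j * i   ≡⟨ *-suc (k ^ j) i ⟨
        k ^ j * suc i       ≤⟨ *-monoʳ-≤ (k ^ j) i<k ⟩
        k ^ j * k           ≡⟨ *-comm (k ^ j) k ⟩
        k ^ suc j           ∎
        where open ≤-Reasoning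

  lincomb-T : ∀ i L → T p k i (lincomb p L) ≈ lincomb p (List.map (map₂ (T p k i)) L)
  lincomb-T i []            n = refl
  lincomb-T i ((c , s) ∷ L) n = cong (λ z → (toℕ c * toℕ (s (k * n + i)) + toℕ z) mod p) (lincomb-T i L n)

  M-T : ∀ {a b i} → i < k → M p k a b → M p k a (T p k i b)
  M-T {a} {i = i} i<k (L , L⊆kernel , b≈L) =
    List.map (map₂ (T p k i)) L , All.map⁺ (All.map (Kernel-T {a} i<k) L⊆kernel) ,
    λ n → trans (b≈L (k * n + i)) (lincomb-T i L n)

  M-T* : ∀ {a b w} → Digits w → M p k a b → M p k a (T* w b)
  M-T* []         b∈M = b∈M
  M-T* {a} (i<k ∷ dw) b∈M = M-T* {a} dw (M-T {a} i<k b∈M)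

  T*-injective : ∀ {a} → (∀ i → i < k → TInvertible p k i a) → ∀ {w b c} → Digits w →
                 M p k a b → M p k a c → T* w b ≈ T* w c → b ≈ c
  T*-injective inv []         b∈M c∈M same = same
  T*-injective {a} inv {b = b} {c} (i<k ∷ dw) b∈M c∈M same =
    proj₁ (inv _ i<k) b c b∈M c∈M (T*-injective {a} inv dw (M-T {a} {b} i<k b∈M) (M-T {a} {c} i<k c∈M) same)

  -- Injectivity of T*(w ^ʷ i) cancels the common tail of the two powers.
  T*-^ʷ-return : ∀ {a} → (∀ i → i < k → TInvertible p k i a) → ∀ {w b} → Digits w → M p k a b →
                 ∀ {i j} → i < j → T* (w ^ʷ i) b ≈ T* (w ^ʷ j) b → T* (w ^ʷ (j ∸ suc i)) (T* w b) ≈ b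
  T*-^ʷ-return {a} inv {w} {b} dw b∈M {i} {j} i<j loop n = sym (trans (b≈ n) (cong (λ f → f n) (T*-++ w (w ^ʷ d) b)))
    where
      d = j ∸ suc i
      j≡ : j ≡ suc d + i
      j≡ = trans (sym (m∸n+n≡m i<j)) (+-suc d i)
      T*-^ʷj : T* (w ^ʷ j) b ≡ T* (w ^ʷ i) (T* (w ^ʷ suc d) b)
      T*-^ʷj = trans (cong (λ e → T* (w ^ʷ e) b) j≡)
                     (trans (cong (λ u → T* u b) (^ʷ-+ w (suc d) i)) (T*-++ (w ^ʷ suc d) (w ^ʷ i) b))
      b≈ : b ≈ T* (w ^ʷ suc d) b
      b≈ = T*-injective {a} inv (All-^ʷ dw i) b∈M (M-T* {a} (All-^ʷ dw (suc d)) b∈M)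
             (λ n → trans (loop n) (cong (λ f → f n) T*-^ʷj))

module Mismatch {p : ℕ} .{{_ : NonZero p}} {k : ℕ} (1<k : 1 < k) (a a' : Seq p)
  (reg : Regular p k a) (reg' : Regular p k a')
  (inv : ∀ i → i < k → TInvertible p k i a) (inv' : ∀ i → i < k → TInvertible p k i a') where

  instance
    k≢0 : NonZero k
    k≢0 = >-nonZero (<⇒≤ 1<k)

  open Words {k = k}

  State : Set
  State = Seq p × Seq p

  _≈²_ : State → State → Set
  _≈²_ = Pointwise _≈_ _≈_

  M² : State → Set
  M² y = M p k a (proj₁ y) × M p k a' (proj₂ y)

  T*² : List ℕ → State → State
  T*² w y = T* w (proj₁ y) , T* w (proj₂ y)

  M²-T*² : ∀ {u y} → Digits u → M² y → M² (T*² u y)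
  M²-T*² du (b∈M , b'∈M') = M-T* {a = a} du b∈M , M-T* {a = a'} du b'∈M'

  open Finite (Finite-× (regular-finite {a = a} reg) (regular-finite {a = a'} reg')) using (size; pigeonhole)

  -- A state repeated along the prefixes of u is a loop, which can be cut out of u.
  shorten : ∀ fuel {y} → M² y → ∀ u → Digits u → length u ≤ fuel →
            ∃ λ v → Digits v × length v ≤ size × T*² u y ≈² T*² v y
  shorten fuel y∈ u du _ with length u ≤? size
  ... | yes short = u , du , short , (λ _ → refl) , (λ _ → refl)
  shorten zero    y∈ u du |u|≤0      | no long = contradiction (≤-trans |u|≤0 z≤n) long
  shorten (suc fuel) {y} y∈ u du |u|≤1+fuel | no long =
    let i , j , i<j , j≤size , loop₁ , loop₂ =
          pigeonhole (λ i → T*² (take i u) y) (λ i → M²-T*² (All.take⁺ i du) y∈)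
        |u'|<|u| = length-take++drop< u i<j (≤-trans j≤size (<⇒≤ (≰⇒> long)))
        v , dv , short , same₁ , same₂ =
          shorten fuel y∈ (take i u ++ drop j u) (All.++⁺ (All.take⁺ i du) (All.drop⁺ j du))
                  (≤-pred (≤-trans |u'|<|u| |u|≤1+fuel))
    in v , dv , short , (λ n → trans (T*-removeLoop u i j _ loop₁ n) (same₁ n))
                      , (λ n → trans (T*-removeLoop u i j _ loop₂ n) (same₂ n))

  start : State
  start = a , a'

  start∈M² : M² start
  start∈M² = M-self k a , M-self k a'

  return : ∀ w → Digits w → ∃ λ v → Digits v × T*² v (T*² w start) ≈² start
  return w dw =
    let i , j , i<j , _ , loop₁ , loop₂ =
          pigeonhole (λ i → T*² (w ^ʷ i) start) (λ i → M²-T*² (All-^ʷ dw i) start∈M²)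
    in w ^ʷ (j ∸ suc i) , All-^ʷ dw (j ∸ suc i) ,
       T*-^ʷ-return {a = a} inv dw (M-self k a) i<j loop₁ , T*-^ʷ-return {a = a'} inv' dw (M-self k a') i<j loop₂

  bound : ℕ → ℕ
  bound n₀ = k ^ size * suc n₀

  mismatch-persists : ∀ {n₀} → a n₀ ≢ a' n₀ → ∀ w → Digits w →
                      ∃ λ m → m < bound n₀ × T* w a m ≢ T* w a' m
  mismatch-persists {n₀} a≢a' w dw =
    let v , dv , back₁ , back₂ = return w dw
        v' , dv' , short , same₁ , same₂ = shorten (length v) (M²-T*² dw start∈M²) v dv ≤-refl
        m = k ^ length v' * n₀ + fromDigits v'
    in m , <-≤-trans (shift+fromDigits< dv' n₀) (*-monoˡ-≤ (suc n₀) (^-monoʳ-≤ k short)) , λ eq → a≢a' (begin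
      a n₀                 ≡⟨ back₁ n₀ ⟨
      T* v (T* w a) n₀     ≡⟨ same₁ n₀ ⟩
      T* v' (T* w a) n₀    ≡⟨ T*-index v' _ n₀ ⟩
      T* w a m             ≡⟨ eq ⟩
      T* w a' m            ≡⟨ T*-index v' _ n₀ ⟨
      T* v' (T* w a') n₀   ≡⟨ same₂ n₀ ⟨
      T* v (T* w a') n₀    ≡⟨ back₂ n₀ ⟩
      a' n₀                ∎)
    where open ≡-Reasoning

  mismatch-in-every-residue : ∀ {n₀} → a n₀ ≢ a' n₀ → ∀ N r → r < k ^ N →
                              ∃ λ m → m < bound n₀ × a (k ^ N * m + r) ≢ a' (k ^ N * m + r)
  mismatch-in-every-residue a≢a' N r r<k^N =
    let m , m<bound , differs = mismatch-persists a≢a' (toDigits N r) (toDigits-digits N r)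
    in m , m<bound , λ eq → differs (trans (T*-toDigits N r r<k^N a m) (trans eq (sym (T*-toDigits N r r<k^N a' m))))

  mismatchIndicator : ℕ → ℕ
  mismatchIndicator n = if does (a n ≟ᶠ a' n) then 0 else 1

  diffCount-sumBelow : ∀ N → diffCount a a' N ≡ sumBelow mismatchIndicator N
  diffCount-sumBelow zero    = refl
  diffCount-sumBelow (suc N) = cong (_+ mismatchIndicator N) (diffCount-sumBelow N)

  mismatchIndicator-≢ : ∀ {n} → a n ≢ a' n → 1 ≤ mismatchIndicator n
  mismatchIndicator-≢ {n} a≢a' with a n ≟ᶠ a' n
  ... | yes eq = contradiction eq a≢a'
  ... | no _   = ≤-refl

  mismatch-dense : ∀ {n₀} → a n₀ ≢ a' n₀ → ∀ N → k ^ N ≤ diffCount a a' (bound n₀ * k ^ N)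
  mismatch-dense {n₀} a≢a' N = subst (k ^ N ≤_) (sym (diffCount-sumBelow (bound n₀ * k ^ N)))
    (hitsEveryResidue⇒≤sumBelow mismatchIndicator (k ^ N) (bound n₀) λ r r<k^N →
      let m , m<bound , differs = mismatch-in-every-residue a≢a' N r r<k^N
      in m , m<bound , mismatchIndicator-≢ differs)

  mismatch⇒¬AsympEq : ∀ {n₀} → a n₀ ≢ a' n₀ → ¬ AsympEq a a'
  mismatch⇒¬AsympEq {n₀} a≢a' =
    dense⇒¬Sparse 1<k (diffCount a a') (bound n₀) {{m*n≢0 (k ^ size) (suc n₀) {{m^n≢0 k size}}}}
                  (mismatch-dense a≢a')

lemma7p3 : (k : ℕ) → 2 ≤ k → (p : ℕ) → .{{_ : NonZero p}} → Prime p →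
    (a a' : Seq p) → Regular p k a → Regular p k a' →
    (∀ i → i < k → TInvertible p k i a) →
    (∀ i → i < k → TInvertible p k i a') →
    AsympEq a a' → a ≈ a'
lemma7p3 k 2≤k p _ a a' reg reg' inv inv' asymp n with a n ≟ᶠ a' n
... | yes eq   = eq
... | no a≢a' = contradiction asymp (Mismatch.mismatch⇒¬AsympEq 2≤k a a' reg reg' inv inv' a≢a')
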